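{- Let $n\ge 1$. Every poset in $\mathcal{F}^{1}_{n,2}$ is a lattice.
   Context: Let $[n]=\{1,\ldots,n\}$. The ground set of the poset $F_{n,2}$ consists of $\emptyset$ and all subsets of $[n]$ of size $1$ or $2$. Identify each nonempty such set $S$ with the pair $(a,b)$, where $a=\max S$ and $b$ is the other element of $S$ if $|S|=2$ and $b=0$ if $|S|=1$. The order of $F_{n,2}$: $\emptyset$ is the minimum, and $(a,b)\preceq(c,d)$ iff $a\le c$ and $b\le d$. A refinement of a poset is a partial order on the same ground set whose order relation contains the original one. $\mathcal{F}^{1}_{n,2}$ is the set of partial orders $P$ on the ground set of $F_{n,2}$ such that (i) $P$ refines $F_{n,2}$, (ii) every singleton set $\{i\}$ is comparable in $P$ with every element of the ground set, and (iii) $P$ is minimal with respect to inclusion of order relations among all partial orders satisfying (i) and (ii). A lattice is a poset in which every pair of elements has a least upper bound and a greatest lower bound. -}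

module Defs where

open import Data.Nat using (ℕ; zero; suc; _≤_; _<_)
open import Data.Bool using (Bool; true)
open import Data.Product using (_×_; Σ-syntax)
open import Data.Sum using (_⊎_)
open import Data.Unit using (⊤)
open import Data.Empty using (⊥)
open import Relation.Binary.PropositionalEquality using (_≡_)

-- Ground set of F_{n,2}: ∅ and the pairs (a,b) with 0 ≤ b < a ≤ n,
-- where (a,0) encodes the singleton {a} and (a,b), b ≥ 1, encodes {b,a}.
-- The side conditions are irrelevant, so equality depends only on a and b.
data Elem (n : ℕ) : Set where
  ∅   : Elem n
  ⟨_,_⟩ : (a b : ℕ) → .(b < a) → .(a ≤ n) → Elem n

_≼F_ : {n : ℕ} → Elem n → Elem n → Set
∅ ≼F y = ⊤
⟨ a , b ⟩ _ _ ≼F ∅ = ⊥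
⟨ a , b ⟩ _ _ ≼F ⟨ c , d ⟩ _ _ = (a ≤ c) × (b ≤ d)

Rel : ℕ → Set
Rel n = Elem n → Elem n → Bool

_∋_≤_ : {n : ℕ} → Rel n → Elem n → Elem n → Set
P ∋ x ≤ y = P x y ≡ true

IsPartialOrder : {n : ℕ} → Rel n → Set
IsPartialOrder {n} P =
  ((x : Elem n) → P ∋ x ≤ x) ×
  ((x y : Elem n) → P ∋ x ≤ y → P ∋ y ≤ x → x ≡ y) ×
  ((x y z : Elem n) → P ∋ x ≤ y → P ∋ y ≤ z → P ∋ x ≤ z)

_⊆R_ : {n : ℕ} → Rel n → Rel n → Set
_⊆R_ {n} P Q = (x y : Elem n) → P ∋ x ≤ y → Q ∋ x ≤ y

Refines : {n : ℕ} → Rel n → Set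
Refines {n} P = (x y : Elem n) → x ≼F y → P ∋ x ≤ y

SingletonsComparable : {n : ℕ} → Rel n → Set
SingletonsComparable {n} P =
  (i : ℕ) → (i0 : 0 < i) → (i≤n : i ≤ n) → (x : Elem n) →
  (P ∋ ⟨ i , 0 ⟩ i0 i≤n ≤ x) ⊎ (P ∋ x ≤ ⟨ i , 0 ⟩ i0 i≤n)

Admissible : {n : ℕ} → Rel n → Set
Admissible P = IsPartialOrder P × Refines P × SingletonsComparable P

InF1 : (n : ℕ) → Rel n → Set
InF1 n P = Admissible P × ((Q : Rel n) → Admissible Q → Q ⊆R P → P ⊆R Q)

IsLattice : {n : ℕ} → Rel n → Set
IsLattice {n} P = (x y : Elem n) →
  (Σ[ j ∈ Elem n ] (P ∋ x ≤ j × P ∋ y ≤ j ×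
      ((w : Elem n) → P ∋ x ≤ w → P ∋ y ≤ w → P ∋ j ≤ w))) ×
  (Σ[ m ∈ Elem n ] (P ∋ m ≤ x × P ∋ m ≤ y ×
      ((w : Elem n) → P ∋ w ≤ x → P ∋ w ≤ y → P ∋ w ≤ m)))

module Submission where

-- Between two 2-element sets, keep only the relations of P that hold in F_{n,2} or pass
-- through a singleton: this pruned relation is again admissible and contained in P, so by
-- minimality it is P. Incomparable x and y are then both 2-element sets (∅ is the bottom and
-- singletons are comparable with everything), and every common upper bound of them lies
-- above their coordinatewise join x ∨ y or above a singleton that is itself a common upper
-- bound. The singletons form a chain, so the least singleton upper bound t exists (when any
-- does); t is comparable with x ∨ y, and the smaller of the two is the join. The meet is
-- the same argument in the dual order, with x ∧ y and the greatest singleton lower bound.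

open import Defs
open import Data.Nat using (ℕ; zero; suc; _≤_; _<_; z<s; _⊔_; _⊓_; _≤?_; _<?_)
open import Data.Nat.Properties
  using (≤-refl; ≤-trans; ⊔-mono-<; ⊓-mono-<; ⊔-lub; ⊓-glb; m≤m⊔n; m≤n⊔m; m⊓n≤m; m⊓n≤n)
open import Data.Fin using (Fin; zero; suc; toℕ; fromℕ<)
open import Data.Fin.Properties using (toℕ<n; toℕ-fromℕ<; any?)
open import Data.Bool using (true)
open import Data.Bool.Properties using (_≟_)
open import Data.Product using (_×_; _,_; proj₁; proj₂; ∃; ∃-syntax)
open import Data.Sum using (_⊎_; inj₁; inj₂; [_,_]′; swap; map; map₂)
open import Data.Unit using (tt)
open import Data.Empty using (⊥; ⊥-elim)
open import Function using (_∘_; id; flip)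
open import Relation.Nullary using (¬_; Dec; yes; no; does; contradiction)
open import Relation.Nullary.Decidable using (_×-dec_; _⊎-dec_; _→-dec_; dec-true)
open import Relation.Binary.Definitions using (Reflexive; Transitive; Decidable)
open import Relation.Binary.PropositionalEquality using (_≡_; refl; sym; cong; subst)

module _ {A : Set} where

  UpperBound : (A → A → Set) → A → A → A → Set
  UpperBound _≤_ x y u = x ≤ u × y ≤ u

  IsJoin : (A → A → Set) → A → A → A → Set
  IsJoin _≤_ x y j = x ≤ j × y ≤ j × (∀ w → x ≤ w → y ≤ w → j ≤ w)

  ComparableWithAll : (A → A → Set) → A → Set
  ComparableWithAll _≤_ s = ∀ w → s ≤ w ⊎ w ≤ s

  FactorsVia : (A → A → Set) → (A → A → Set) → ∀ {k} → (Fin k → A) → A → Set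
  FactorsVia _≤_ _⊑_ s z = ∀ w → z ≤ w → z ⊑ w ⊎ ∃[ i ] (z ≤ s i × s i ≤ w)

module Joins {A : Set} {_≤_ : A → A → Set}
  (≤-refl : Reflexive _≤_) (≤-trans : Transitive _≤_) (_≤?_ : Decidable _≤_) where

  above-comparable : ∀ {x y s} → s ≤ y ⊎ y ≤ s → x ≤ s → ¬ x ≤ y → y ≤ s
  above-comparable (inj₁ s≤y) x≤s x≰y = contradiction (≤-trans x≤s s≤y) x≰y
  above-comparable (inj₂ y≤s) _   _   = y≤s

  least-satisfying : ∀ {k} (s : Fin k → A) → (∀ i j → s i ≤ s j ⊎ s j ≤ s i) →
    {Q : A → Set} → (∀ a → Dec (Q a)) →
    (∀ i → ¬ Q (s i)) ⊎ ∃[ i ] (Q (s i) × ∀ j → Q (s j) → s i ≤ s j)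
  least-satisfying {zero} s _ _ = inj₁ λ ()
  least-satisfying {suc k} s chain Q?
    with least-satisfying (s ∘ suc) (λ i j → chain (suc i) (suc j)) Q? | Q? (s zero)
  ... | inj₁ none | no ¬q₀ = inj₁ λ { zero → ¬q₀ ; (suc i) → none i }
  ... | inj₁ none | yes q₀ =
    inj₂ (zero , q₀ , λ { zero _ → ≤-refl ; (suc j) q → contradiction q (none j) })
  ... | inj₂ (t , qt , least) | no ¬q₀ =
    inj₂ (suc t , qt , λ { zero q → contradiction q ¬q₀ ; (suc j) → least j })
  ... | inj₂ (t , qt , least) | yes q₀ with chain zero (suc t)
  ...   | inj₁ s₀≤sₜ = inj₂ (zero , q₀ , λ { zero _ → ≤-refl ; (suc j) q → ≤-trans s₀≤sₜ (least j q) })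
  ...   | inj₂ sₜ≤s₀ = inj₂ (suc t , qt , λ { zero _ → sₜ≤s₀ ; (suc j) → least j })

  join-of-two-candidates : ∀ {x y a b} → UpperBound _≤_ x y a → UpperBound _≤_ x y b →
    a ≤ b ⊎ b ≤ a → (∀ w → UpperBound _≤_ x y w → a ≤ w ⊎ b ≤ w) → ∃ (IsJoin _≤_ x y)
  join-of-two-candidates {a = a} (x≤a , y≤a) _ (inj₁ a≤b) cases =
    a , x≤a , y≤a , λ w x≤w y≤w → [ id , ≤-trans a≤b ]′ (cases w (x≤w , y≤w))
  join-of-two-candidates {b = b} _ (x≤b , y≤b) (inj₂ b≤a) cases =
    b , x≤b , y≤b , λ w x≤w y≤w → [ ≤-trans b≤a , id ]′ (cases w (x≤w , y≤w))

  join-from-family : ∀ {k x y m} (s : Fin k → A) → (∀ i → ComparableWithAll _≤_ (s i)) →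
    UpperBound _≤_ x y m →
    (∀ w → UpperBound _≤_ x y w → m ≤ w ⊎ ∃[ i ] (UpperBound _≤_ x y (s i) × s i ≤ w)) →
    ∃ (IsJoin _≤_ x y)
  join-from-family {x = x} {y} {m} s comparable m-ub cases
    with least-satisfying s (λ i j → comparable i (s j)) (λ w → (x ≤? w) ×-dec (y ≤? w))
  ... | inj₁ none =
    m , proj₁ m-ub , proj₂ m-ub , λ w x≤w y≤w →
      [ id , (λ { (i , i-ub , _) → contradiction i-ub (none i) }) ]′ (cases w (x≤w , y≤w))
  ... | inj₂ (t , t-ub , least) =
    join-of-two-candidates m-ub t-ub (swap (comparable t m)) λ w w-ub →
      map₂ (λ { (i , i-ub , sᵢ≤w) → ≤-trans (least i i-ub) sᵢ≤w }) (cases w w-ub)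

  join-of-comparable : ∀ {x y} → x ≤ y ⊎ y ≤ x → ∃ (IsJoin _≤_ x y)
  join-of-comparable {y = y} (inj₁ x≤y) = y , x≤y , ≤-refl , λ _ _ y≤w → y≤w
  join-of-comparable {x = x} (inj₂ y≤x) = x , ≤-refl , y≤x , λ _ x≤w _ → x≤w

  join-of-incomparable : ∀ {k x y j} {_⊑_ : A → A → Set} (s : Fin k → A) →
    (∀ i → ComparableWithAll _≤_ (s i)) → (∀ {u v} → u ⊑ v → u ≤ v) → IsJoin _⊑_ x y j →
    FactorsVia _≤_ _⊑_ s x → FactorsVia _≤_ _⊑_ s y → ¬ x ≤ y → ¬ y ≤ x →
    ∃ (IsJoin _≤_ x y)
  join-of-incomparable {x = x} {y} {j} s comparable ⊑⇒≤ (x⊑j , y⊑j , j-least)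
    x-factors y-factors x≰y y≰x =
    join-from-family s comparable (⊑⇒≤ x⊑j , ⊑⇒≤ y⊑j) upper-bound-cases
    where
    upper-bound-cases : ∀ w → UpperBound _≤_ x y w →
      j ≤ w ⊎ ∃[ i ] (UpperBound _≤_ x y (s i) × s i ≤ w)
    upper-bound-cases w (x≤w , y≤w) with x-factors w x≤w | y-factors w y≤w
    ... | inj₁ x⊑w | inj₁ y⊑w = inj₁ (⊑⇒≤ (j-least w x⊑w y⊑w))
    ... | inj₂ (i , x≤sᵢ , sᵢ≤w) | _ =
      inj₂ (i , (x≤sᵢ , above-comparable (comparable i y) x≤sᵢ x≰y) , sᵢ≤w)
    ... | inj₁ _ | inj₂ (i , y≤sᵢ , sᵢ≤w) =
      inj₂ (i , (above-comparable (comparable i x) y≤sᵢ y≰x , y≤sᵢ) , sᵢ≤w)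

module _ {n : ℕ} where

  ≼F-refl : Reflexive (_≼F_ {n})
  ≼F-refl {∅}             = tt
  ≼F-refl {⟨ _ , _ ⟩ _ _} = ≤-refl , ≤-refl

  ≼F-trans : Transitive (_≼F_ {n})
  ≼F-trans {∅}             _         _         = tt
  ≼F-trans {⟨ _ , _ ⟩ _ _} {∅}       ()
  ≼F-trans {⟨ _ , _ ⟩ _ _} {⟨ _ , _ ⟩ _ _} {∅} _ ()
  ≼F-trans {⟨ _ , _ ⟩ _ _} {⟨ _ , _ ⟩ _ _} {⟨ _ , _ ⟩ _ _} (a≤c , b≤d) (c≤e , d≤f) =
    ≤-trans a≤c c≤e , ≤-trans b≤d d≤f

  _∨F_ : Elem n → Elem n → Elem n
  ∅ ∨F y = y
  x@(⟨ _ , _ ⟩ _ _) ∨F ∅ = x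
  ⟨ a , b ⟩ p q ∨F ⟨ c , d ⟩ r s = ⟨ a ⊔ c , b ⊔ d ⟩ (⊔-mono-< p r) (⊔-lub q s)

  _∧F_ : Elem n → Elem n → Elem n
  ∅ ∧F _ = ∅
  ⟨ _ , _ ⟩ _ _ ∧F ∅ = ∅
  ⟨ a , b ⟩ p q ∧F ⟨ c , d ⟩ r s = ⟨ a ⊓ c , b ⊓ d ⟩ (⊓-mono-< p r) (≤-trans (m⊓n≤m a c) q)

  ∨F-isJoin : ∀ x y → IsJoin (_≼F_ {n}) x y (x ∨F y)
  ∨F-isJoin ∅ y = tt , ≼F-refl {y} , λ _ _ y≼w → y≼w
  ∨F-isJoin x@(⟨ _ , _ ⟩ _ _) ∅ = ≼F-refl {x} , tt , λ _ x≼w _ → x≼w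
  ∨F-isJoin (⟨ a , b ⟩ _ _) (⟨ c , d ⟩ _ _) =
    (m≤m⊔n a c , m≤m⊔n b d) , (m≤n⊔m a c , m≤n⊔m b d) ,
    λ { ∅ () _ ; (⟨ _ , _ ⟩ _ _) (a≤e , b≤f) (c≤e , d≤f) → ⊔-lub a≤e c≤e , ⊔-lub b≤f d≤f }

  ∧F-isMeet : ∀ x y → IsJoin (flip (_≼F_ {n})) x y (x ∧F y)
  ∧F-isMeet ∅ _ = tt , tt , λ _ w≼∅ _ → w≼∅
  ∧F-isMeet (⟨ _ , _ ⟩ _ _) ∅ = tt , tt , λ _ _ w≼∅ → w≼∅
  ∧F-isMeet (⟨ a , b ⟩ _ _) (⟨ c , d ⟩ _ _) =
    (m⊓n≤m a c , m⊓n≤m b d) , (m⊓n≤n a c , m⊓n≤n b d) ,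
    λ { ∅ _ _ → tt ; (⟨ _ , _ ⟩ _ _) (e≤a , f≤b) (e≤c , f≤d) → ⊓-glb e≤a e≤c , ⊓-glb f≤b f≤d }

  _≼F?_ : Decidable (_≼F_ {n})
  ∅ ≼F? _ = yes tt
  ⟨ _ , _ ⟩ _ _ ≼F? ∅ = no λ ()
  ⟨ a , b ⟩ _ _ ≼F? ⟨ c , d ⟩ _ _ = (a ≤? c) ×-dec (b ≤? d)

  IsPair : Elem n → Set
  IsPair ∅ = ⊥
  IsPair (⟨ _ , b ⟩ _ _) = 0 < b

  isPair? : ∀ x → Dec (IsPair x)
  isPair? ∅ = no λ ()
  isPair? (⟨ _ , b ⟩ _ _) = 0 <? b

  singleton : Fin n → Elem n
  singleton k = ⟨ suc (toℕ k) , 0 ⟩ z<s (toℕ<n k)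

  singleton-onto : ∀ {a} .(p : 0 < a) .(q : a ≤ n) → ∃[ k ] (⟨ a , 0 ⟩ p q ≡ singleton k)
  singleton-onto {suc a} _ q = fromℕ< q , first-cong (cong suc (sym (toℕ-fromℕ< {n = n} q)))
    where
    first-cong : ∀ {a c} .{p q r s} → a ≡ c → _≡_ {A = Elem n} (⟨ a , 0 ⟩ p q) (⟨ c , 0 ⟩ r s)
    first-cong refl = refl

does-true⇒ : {A : Set} (a? : Dec A) → does a? ≡ true → A
does-true⇒ (yes a) _ = a

_∋_≤?_ : ∀ {n} (P : Rel n) → Decidable (P ∋_≤_)
P ∋ x ≤? y = P x y ≟ true

module _ {n : ℕ} (P : Rel n) where

  Through : Elem n → Elem n → Set
  Through x y = ∃[ k ] (P ∋ x ≤ singleton k × P ∋ singleton k ≤ y)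

  Essential : Elem n → Elem n → Set
  Essential x y = IsPair x → IsPair y → x ≼F y ⊎ Through x y

  essential? : ∀ x y → Dec (Essential x y)
  essential? x y = isPair? x →-dec isPair? y →-dec
    ((x ≼F? y) ⊎-dec any? (λ k → (P ∋ x ≤? singleton k) ×-dec (P ∋ singleton k ≤? y)))

  essential-≤? : ∀ x y → Dec (P ∋ x ≤ y × Essential x y)
  essential-≤? x y = (P ∋ x ≤? y) ×-dec essential? x y

  prune : Rel n
  prune x y = does (essential-≤? x y)

module AdmissibleOrder {n : ℕ} {P : Rel n} (adm : Admissible P) where

  P-refl : Reflexive (P ∋_≤_)
  P-refl {x} = proj₁ (proj₁ adm) x

  P-antisym : ∀ {x y} → P ∋ x ≤ y → P ∋ y ≤ x → x ≡ y
  P-antisym = proj₁ (proj₂ (proj₁ adm)) _ _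

  P-trans : Transitive (P ∋_≤_)
  P-trans = proj₂ (proj₂ (proj₁ adm)) _ _ _

  refines : ∀ {x y} → x ≼F y → P ∋ x ≤ y
  refines = proj₁ (proj₂ adm) _ _

  singleton-comparable : ∀ k → ComparableWithAll (P ∋_≤_) (singleton k)
  singleton-comparable k = proj₂ (proj₂ adm) (suc (toℕ k)) z<s (toℕ<n k)

  below-∅ : ∀ {x} → P ∋ x ≤ ∅ → x ≡ ∅
  below-∅ x≤∅ = P-antisym x≤∅ (refines tt)

  essential-trans : ∀ {x y z} → P ∋ x ≤ y → P ∋ y ≤ z →
    Essential P x y → Essential P y z → Essential P x z
  essential-trans {y = ∅} x≤∅ _ _ _ x-pair _ = ⊥-elim (subst IsPair (below-∅ x≤∅) x-pair)
  essential-trans {y = ⟨ c , zero ⟩ p q} x≤y y≤z _ _ _ _ with singleton-onto p q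
  ... | k , refl = inj₂ (k , x≤y , y≤z)
  essential-trans {y = ⟨ c , suc d ⟩ _ _} x≤y y≤z xy yz x-pair z-pair
    with xy x-pair z<s | yz z<s z-pair
  ... | inj₁ x≼y | inj₁ y≼z = inj₁ (≼F-trans x≼y y≼z)
  ... | inj₁ x≼y | inj₂ (k , y≤s , s≤z) = inj₂ (k , P-trans (refines x≼y) y≤s , s≤z)
  ... | inj₂ (k , x≤s , s≤y) | _ = inj₂ (k , x≤s , P-trans s≤y y≤z)

  prune-⊆ : prune P ⊆R P
  prune-⊆ x y h = proj₁ (does-true⇒ (essential-≤? P x y) h)

  prune-essential : ∀ {x y} → prune P ∋ x ≤ y → Essential P x y
  prune-essential {x} {y} h = proj₂ (does-true⇒ (essential-≤? P x y) h)

  prune-intro : ∀ {x y} → P ∋ x ≤ y → Essential P x y → prune P ∋ x ≤ y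
  prune-intro {x} {y} x≤y e = dec-true (essential-≤? P x y) (x≤y , e)

  prune-admissible : Admissible (prune P)
  prune-admissible = (prune-refl , prune-antisym , prune-trans) , prune-refines , prune-comparable
    where
    prune-refl : ∀ x → prune P ∋ x ≤ x
    prune-refl x = prune-intro P-refl λ _ _ → inj₁ (≼F-refl {x = x})

    prune-antisym : ∀ x y → prune P ∋ x ≤ y → prune P ∋ y ≤ x → x ≡ y
    prune-antisym x y h h′ = P-antisym (prune-⊆ x y h) (prune-⊆ y x h′)

    prune-trans : ∀ x y z → prune P ∋ x ≤ y → prune P ∋ y ≤ z → prune P ∋ x ≤ z
    prune-trans x y z h h′ = prune-intro (P-trans (prune-⊆ x y h) (prune-⊆ y z h′))
      (essential-trans (prune-⊆ x y h) (prune-⊆ y z h′) (prune-essential h) (prune-essential h′))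

    prune-refines : Refines (prune P)
    prune-refines x y x≼y = prune-intro (refines x≼y) λ _ _ → inj₁ x≼y

    prune-comparable : SingletonsComparable (prune P)
    prune-comparable i i0 i≤n x = map (λ h → prune-intro h λ ()) (λ h → prune-intro h λ _ ())
      (proj₂ (proj₂ adm) i i0 i≤n x)

module _ {n : ℕ} {P : Rel n} (adm : Admissible P)
  (minimal : (Q : Rel n) → Admissible Q → Q ⊆R P → P ⊆R Q) where
  open AdmissibleOrder adm

  essential-of-minimal : ∀ {x y} → P ∋ x ≤ y → Essential P x y
  essential-of-minimal {x} {y} x≤y =
    prune-essential (minimal (prune P) prune-admissible prune-⊆ x y x≤y)

  pair-factors-above : ∀ {x} → IsPair x → FactorsVia (P ∋_≤_) _≼F_ singleton x
  pair-factors-above x-pair ∅ x≤∅ = ⊥-elim (subst IsPair (below-∅ x≤∅) x-pair)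
  pair-factors-above x-pair (⟨ c , zero ⟩ p q) x≤w with singleton-onto p q
  ... | k , refl = inj₂ (k , x≤w , P-refl)
  pair-factors-above x-pair (⟨ c , suc d ⟩ _ _) x≤w = essential-of-minimal x≤w x-pair z<s

  pair-factors-below : ∀ {x} → IsPair x → FactorsVia (flip (P ∋_≤_)) (flip _≼F_) singleton x
  pair-factors-below x-pair ∅ _ = inj₁ tt
  pair-factors-below x-pair (⟨ c , zero ⟩ p q) w≤x with singleton-onto p q
  ... | k , refl = inj₂ (k , w≤x , P-refl)
  pair-factors-below x-pair (⟨ c , suc d ⟩ _ _) w≤x =
    map₂ (λ { (k , w≤s , s≤x) → k , s≤x , w≤s }) (essential-of-minimal w≤x z<s x-pair)

  incomparable⇒isPair : ∀ {x y} → ¬ P ∋ x ≤ y → ¬ P ∋ y ≤ x → IsPair x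
  incomparable⇒isPair {∅} x≰y _ = x≰y (refines tt)
  incomparable⇒isPair {⟨ _ , zero ⟩ p q} {y} x≰y y≰x with singleton-onto p q
  ... | k , refl = ⊥-elim ([ x≰y , y≰x ]′ (singleton-comparable k y))
  incomparable⇒isPair {⟨ _ , suc _ ⟩ _ _} _ _ = z<s

  module Join = Joins P-refl P-trans (P ∋_≤?_)
  module Meet = Joins {_≤_ = flip (P ∋_≤_)} P-refl (flip P-trans) (flip (P ∋_≤?_))

  F1-isLattice : IsLattice P
  F1-isLattice x y with (P ∋ x ≤? y) ⊎-dec (P ∋ y ≤? x)
  ... | yes comparable = Join.join-of-comparable comparable , Meet.join-of-comparable (swap comparable)
  ... | no incomparable =
    Join.join-of-incomparable singleton singleton-comparable refines (∨F-isJoin x y)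
      (pair-factors-above x-pair) (pair-factors-above y-pair) x≰y y≰x ,
    Meet.join-of-incomparable singleton (λ k → swap ∘ singleton-comparable k) refines (∧F-isMeet x y)
      (pair-factors-below x-pair) (pair-factors-below y-pair) y≰x x≰y
    where
    x≰y : ¬ P ∋ x ≤ y
    x≰y = incomparable ∘ inj₁
    y≰x : ¬ P ∋ y ≤ x
    y≰x = incomparable ∘ inj₂
    x-pair : IsPair x
    x-pair = incomparable⇒isPair x≰y y≰x
    y-pair : IsPair y
    y-pair = incomparable⇒isPair y≰x x≰y

mainTheorem2 : (n : ℕ) → 1 ≤ n → (P : Rel n) → InF1 n P → IsLattice P
mainTheorem2 _ _ _ (adm , minimal) = F1-isLattice adm minimal
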